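{- Let $p$ be a prime and $\lambda \geq 1$ an integer. For all integers $r$ and $n$ with $n \geq \lambda$, every coefficient of $q^k$ with $k < pn - (p-1)(\lambda - 1)$ in the power series $\bigl(1 - (1-q)^{rp}\bigr)^n \in \mathbb{Z}[[q]]$ is divisible by $p^{\lambda}$; that is, $$\bigl(1 - (1-q)^{rp}\bigr)^n \equiv O\bigl(q^{pn - (p-1)(\lambda-1)}\bigr) \pmod{p^{\lambda}}.$$
   Context: For negative exponents, $(1-q)^{k}$ denotes the usual power series expansion in $\mathbb{Z}[[q]]$. -}

module Defs where

open import Data.Nat using (ℕ; zero; suc; _∸_)
open import Data.Integer using (ℤ; +_; -[1+_]; _+_; _*_; -_)

-- Formal power series over ℤ, as coefficient sequences: f k = coefficient of q^k.
PowerSeries : Set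
PowerSeries = ℕ → ℤ

sumTo : ℕ → (ℕ → ℤ) → ℤ
sumTo zero    f = f zero
sumTo (suc n) f = sumTo n f + f (suc n)

_⊛_ : PowerSeries → PowerSeries → PowerSeries
(f ⊛ g) k = sumTo k (λ i → f i * g (k ∸ i))

oneS : PowerSeries
oneS zero    = + 1
oneS (suc _) = + 0

oneMinus : PowerSeries → PowerSeries
oneMinus f k = oneS k + - f k

powS : PowerSeries → ℕ → PowerSeries
powS f zero    = oneS
powS f (suc n) = f ⊛ powS f n

oneMinusQ : PowerSeries
oneMinusQ zero          = + 1
oneMinusQ (suc zero)    = -[1+ 0 ]
oneMinusQ (suc (suc _)) = + 0

-- (1 - q)^{-1} = 1 + q + q^2 + ...
geomS : PowerSeries
geomS _ = + 1

-- (1 - q)^m for an integer m; negative powers are powers of the inverse series.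
oneMinusQPow : ℤ → PowerSeries
oneMinusQPow (+ s)      = powS oneMinusQ s
oneMinusQPow -[1+ s ]   = powS geomS (suc s)

module Submission where

open import Defs
open import Data.Nat using (ℕ; _≤_; _<_; _∸_; _^_)
open import Data.Nat.Primality using (Prime)
open import Data.Integer using (ℤ; +_)
open import Data.Integer.Divisibility using (_∣_)

open import Data.Nat using (zero; suc; z≤n; s≤s; _<?_)
open import Data.Nat.Primality using (euclidsLemma; ¬prime[0])
open import Data.Integer.Divisibility.Signed as Signed using (∣⇒∣ᵤ; ∣ᵤ⇒∣)
  renaming (_∣_ to _∣ˢ_)
open import Data.Integer.Properties using (+-identityˡ)
open import Data.Empty using (⊥-elim)
open import Data.Sum using (inj₁; inj₂)
open import Relation.Binary.PropositionalEquality
  using (_≡_; refl; sym; trans; cong; cong₂; subst; subst₂; module ≡-Reasoning)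
open import Relation.Nullary using (yes; no)

-- Write f = 1 - (1-q)^{rp}.  The proof rests on two facts.
--
-- (a) f₀ = 0, and p ∣ fⱼ for 0 < j < p.  This follows from the
--     "derivative identity"  j·[(1-q)^z]ⱼ = -z·[(1-q)^{z-1}]ⱼ₋₁,  proved
--     separately for z ≥ 0 (powers of 1 - q) and z < 0 (powers of the
--     geometric series) by induction, using the recurrences expressing
--     multiplication by 1 - q and by 1/(1 - q) on coefficients.  As p ∣ z
--     and p ∤ j, Euclid's lemma gives p ∣ [(1-q)^z]ⱼ.
--
-- (b) For any series f with (a) and any p ≥ 1:  p^{ν+1} ∣ (fⁿ)ₖ  whenever
--     ν < n and k + (p-1)ν < pn.  By induction on n, splitting the Cauchy
--     product fⁿ⁺¹ = f·fⁿ into terms fᵢ(fⁿ)ₖ₋ᵢ: for 0 < i < p one factor p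
--     comes from fᵢ and p^ν from the induction hypothesis; for i ≥ p all of
--     p^{ν+1} comes from (fⁿ)ₖ₋ᵢ, except when ν = n, where (fⁿ)ₖ₋ᵢ = 0
--     because fⁿ = O(qⁿ).

-- Signed divisibility is used throughout, since it is closed under sums;
-- the theorem's unsigned divisibility is recovered at the very end.

module FiniteSums where
  open import Data.Integer using (_+_)
  open import Data.Integer.Properties using (+-assoc; +-identityʳ)
  open import Data.Nat.Properties using (≤-refl; m≤n⇒m≤1+n)

  sumTo-∣ : ∀ {d : ℤ} n (f : ℕ → ℤ) → (∀ i → i ≤ n → d ∣ˢ f i) → d ∣ˢ sumTo n f
  sumTo-∣ zero    f d∣f = d∣f 0 z≤n
  sumTo-∣ (suc n) f d∣f = Signed.∣m∣n⇒∣m+n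
    (sumTo-∣ n f (λ i i≤n → d∣f i (m≤n⇒m≤1+n i≤n))) (d∣f (suc n) ≤-refl)

  sumTo-zero : ∀ n (f : ℕ → ℤ) → (∀ i → i ≤ n → f i ≡ + 0) → sumTo n f ≡ + 0
  sumTo-zero zero    f f≡0 = f≡0 0 z≤n
  sumTo-zero (suc n) f f≡0
    rewrite sumTo-zero n f (λ i i≤n → f≡0 i (m≤n⇒m≤1+n i≤n)) | f≡0 (suc n) ≤-refl = refl

  sumTo-shift : ∀ n (f : ℕ → ℤ) → sumTo (suc n) f ≡ f 0 + sumTo n (λ i → f (suc i))
  sumTo-shift zero    f = refl
  sumTo-shift (suc n) f = trans (cong (_+ f (suc (suc n))) (sumTo-shift n f))
    (+-assoc (f 0) (sumTo n (λ i → f (suc i))) (f (suc (suc n))))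

  sumTo-two : ∀ n (f : ℕ → ℤ) → (∀ i → f (suc (suc i)) ≡ + 0) → sumTo (suc n) f ≡ f 0 + f 1
  sumTo-two zero    f f≡0 = refl
  sumTo-two (suc n) f f≡0 rewrite sumTo-two n f f≡0 | f≡0 n = +-identityʳ (f 0 + f 1)

open FiniteSums

module Recurrences where
  open import Data.Integer using (_+_; _-_; _*_; -[1+_])
  open import Data.Integer.Properties using (*-identityˡ; *-zeroˡ; +-identityʳ)
  open import Data.Integer.Tactic.RingSolver using (solve-∀)

  timesQ : PowerSeries → PowerSeries
  timesQ g zero    = + 0
  timesQ g (suc i) = g i

  powS-constant : ∀ f → f 0 ≡ + 1 → ∀ m → powS f m 0 ≡ + 1
  powS-constant f f₀ zero    = refl
  powS-constant f f₀ (suc m) rewrite f₀ | powS-constant f f₀ m = refl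

  oneMinusQPow-constant : ∀ z → oneMinusQPow z 0 ≡ + 1
  oneMinusQPow-constant (+ m)    = powS-constant oneMinusQ refl m
  oneMinusQPow-constant -[1+ s ] = powS-constant geomS refl (suc s)

  oneMinusQ-⊛ : ∀ g i → (oneMinusQ ⊛ g) i ≡ g i - timesQ g i
  oneMinusQ-⊛ g zero    = trans (*-identityˡ (g 0)) (sym (+-identityʳ (g 0)))
  oneMinusQ-⊛ g (suc i) =
    trans (sumTo-two i _ (λ j → *-zeroˡ (g (i ∸ suc j)))) (unitCombination (g (suc i)) (g i))
    where
    unitCombination : ∀ a b → + 1 * a + -[1+ 0 ] * b ≡ a - b
    unitCombination = solve-∀

  geomS-⊛ : ∀ g i → (geomS ⊛ g) i ≡ g i + timesQ (geomS ⊛ g) i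
  geomS-⊛ g zero    = trans (*-identityˡ (g 0)) (sym (+-identityʳ (g 0)))
  geomS-⊛ g (suc i) = trans (sumTo-shift i _) (cong (_+ (geomS ⊛ g) i) (*-identityˡ (g (suc i))))

open Recurrences

module Derivatives where
  open import Data.Integer using (_+_; _-_; _*_; -_)
  open import Data.Integer.Properties using (*-zeroˡ; *-zeroʳ)
  open import Data.Integer.Tactic.RingSolver using (solve-∀)
  open ≡-Reasoning

  -- The ring computation behind the inductive step for powers of 1 - q.
  binomial-step : ∀ a b X Y A B → (+ 1 + b) * X ≡ - a * A → b * Y ≡ - a * B → Y ≡ A - B →
                  (+ 1 + b) * (X - Y) ≡ - (+ 1 + a) * Y
  binomial-step a b X Y A B hX hY hPascal = begin
    (+ 1 + b) * (X - Y)        ≡⟨ expand a b X Y ⟩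
    (+ 1 + b) * X - Y - b * Y  ≡⟨ cong₂ (λ u v → u - Y - v) hX hY ⟩
    - a * A - Y - - a * B      ≡⟨ collect a A B Y ⟩
    - a * (A - B) - Y          ≡⟨ cong (λ u → - a * u - Y) (sym hPascal) ⟩
    - a * Y - Y                ≡⟨ factor a Y ⟩
    - (+ 1 + a) * Y            ∎
    where
    expand : ∀ a b X Y → (+ 1 + b) * (X - Y) ≡ (+ 1 + b) * X - Y - b * Y
    expand = solve-∀
    collect : ∀ a A B Y → - a * A - Y - - a * B ≡ - a * (A - B) - Y
    collect = solve-∀
    factor : ∀ a Y → - a * Y - Y ≡ - (+ 1 + a) * Y
    factor = solve-∀

  -- The ring computation behind the inductive step for powers of 1/(1 - q).
  geometric-step : ∀ a b U V W → (+ 1 + b) * U ≡ a * V → b * V ≡ (+ 1 + a) * W →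
                   (+ 1 + b) * (U + V) ≡ (+ 1 + a) * (V + W)
  geometric-step a b U V W hU hV = begin
    (+ 1 + b) * (U + V)        ≡⟨ expand b U V ⟩
    (+ 1 + b) * U + V + b * V  ≡⟨ cong₂ (λ u v → u + V + v) hU hV ⟩
    a * V + V + (+ 1 + a) * W  ≡⟨ factor a V W ⟩
    (+ 1 + a) * (V + W)        ∎
    where
    expand : ∀ b U V → (+ 1 + b) * (U + V) ≡ (+ 1 + b) * U + V + b * V
    expand = solve-∀
    factor : ∀ a V W → a * V + V + (+ 1 + a) * W ≡ (+ 1 + a) * (V + W)
    factor = solve-∀

  -- i·[(1-q)^{m+1}]ᵢ = -(m+1)·[q(1-q)^m]ᵢ, i.e. D(1-q)^{m+1} = -(m+1)(1-q)^m.
  binomial-derivative : ∀ m i → + i * powS oneMinusQ (suc m) i ≡ - (+ suc m) * timesQ (powS oneMinusQ m) i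
  binomial-derivative m zero = trans (*-zeroˡ (powS oneMinusQ (suc m) 0)) (sym (*-zeroʳ (- (+ suc m))))
  binomial-derivative zero (suc i) = trans (cong (+ suc i *_) (oneMinusQ-⊛ oneS (suc i))) (linear i)
    where
    linear : ∀ i → + suc i * (oneS (suc i) - timesQ oneS (suc i)) ≡ - (+ 1) * oneS i
    linear zero    = refl
    linear (suc i) = *-zeroʳ (+ suc (suc i))
  binomial-derivative (suc m) (suc i) =
    trans (cong (+ suc i *_) (oneMinusQ-⊛ (powS oneMinusQ (suc m)) (suc i)))
          (binomial-step (+ suc m) (+ i) _ _ _ _
            (binomial-derivative m (suc i)) (binomial-derivative m i)
            (oneMinusQ-⊛ (powS oneMinusQ m) i))

  -- i·[(1-q)^{-m}]ᵢ = m·[q(1-q)^{-m-1}]ᵢ, i.e. D(1-q)^{-m} = m(1-q)^{-m-1}.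
  geometric-derivative : ∀ m i → + i * powS geomS m i ≡ + m * timesQ (powS geomS (suc m)) i
  geometric-derivative m zero = trans (*-zeroˡ (powS geomS m 0)) (sym (*-zeroʳ (+ m)))
  geometric-derivative zero (suc i) = trans (*-zeroʳ (+ suc i)) (sym (*-zeroˡ (powS geomS 1 i)))
  geometric-derivative (suc m) (suc i) =
    trans (cong (+ suc i *_) (geomS-⊛ (powS geomS m) (suc i)))
    (trans (geometric-step (+ m) (+ i) _ _ _
              (geometric-derivative m (suc i)) (geometric-derivative (suc m) i))
           (cong (+ suc m *_) (sym (geomS-⊛ (powS geomS (suc m)) i))))

open Derivatives

module LowCoefficients {p : ℕ} (p-prime : Prime p) where
  open import Data.Integer using (_*_; -_; -[1+_]; ∣_∣)
  open import Data.Integer.Properties using (abs-*)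
  open import Data.Nat.Divisibility using (∣⇒≤; _∣0) renaming (_∣_ to _∣ℕ_)
  open import Data.Nat.Properties using (<⇒≱)

  cancel-unit : ∀ j {X c Y} → suc j < p → + suc j * X ≡ c * Y → + p ∣ˢ c → + p ∣ˢ X
  cancel-unit j {X} {c} {Y} j<p eq p∣c with euclidsLemma (suc j) ∣ X ∣ p-prime p∣jX
    where
    p∣jX : p ∣ℕ suc j Data.Nat.* ∣ X ∣
    p∣jX = subst (p ∣ℕ_) (abs-* (+ suc j) X)
      (∣⇒∣ᵤ (subst (+ p ∣ˢ_) (sym eq) (Signed.∣m⇒∣m*n Y p∣c)))
  ... | inj₁ p∣j = ⊥-elim (<⇒≱ j<p (∣⇒≤ p∣j))
  ... | inj₂ p∣X = ∣ᵤ⇒∣ p∣X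

  low-coefficient : ∀ z j → + p ∣ˢ z → suc j < p → + p ∣ˢ oneMinusQPow z (suc j)
  low-coefficient (+ zero)    _ _   _   = ∣ᵤ⇒∣ (p ∣0)
  low-coefficient (+ suc m)   j p∣z j<p =
    cancel-unit j j<p (binomial-derivative m (suc j)) (Signed.∣m⇒∣-m p∣z)
  low-coefficient -[1+ s ]    j p∣z j<p =
    cancel-unit j j<p (geometric-derivative (suc s) (suc j)) (Signed.∣m⇒∣-m p∣z)

open LowCoefficients

module DegreeBounds where
  open import Data.Nat using (_+_; _*_)
  open import Data.Nat.Properties
    using (<⇒≤; n≮0; m∸n≢0⇒n<m; m≤o∸n⇒m+n≤o; <-≤-trans; m∸n≤m; m∸n+n≡m;
           +-assoc; +-cancelʳ-<; +-monoʳ-≤; module ≤-Reasoning)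
  open import Data.Nat.Tactic.RingSolver using (solve-∀)
  open ≤-Reasoning

  -- The region k + (p-1)ν < pn (with p = p' + 1) in which the coefficient of
  -- qᵏ in fⁿ is claimed to be divisible by p^{ν+1}.
  WithinBound : (p' n ν k : ℕ) → Set
  WithinBound p' n ν k = k + p' * ν < suc p' * n

  -- The statement's form of the bound, with truncated subtraction.
  bound-from-difference : ∀ {k m c} → k < m ∸ c → k + c < m
  bound-from-difference {k} {m} {c} k<m∸c = m≤o∸n⇒m+n≤o (suc k) c≤m k<m∸c
    where
    c≤m : c ≤ m
    c≤m = <⇒≤ (m∸n≢0⇒n<m (λ m∸c≡0 → n≮0 (subst (k <_) m∸c≡0 k<m∸c)))

  shorter-tail : ∀ {j k n} → suc j ≤ k → k < suc n → k ∸ suc j < n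
  shorter-tail {j} {suc k} _ (s≤s k<n) = <-≤-trans (s≤s (m∸n≤m k j)) k<n

  -- If k + c < m + d and d ≤ i ≤ k, then (k - i) + c < m: a factor of
  -- degree i ≥ d uses up at least d of the available degree.
  degree-drop : ∀ {d i k} c m → d ≤ i → i ≤ k → k + c < m + d → (k ∸ i) + c < m
  degree-drop {d} {i} {k} c m d≤i i≤k k+c<m+d = +-cancelʳ-< d ((k ∸ i) + c) m (begin-strict
    (k ∸ i) + c + d  ≤⟨ +-monoʳ-≤ ((k ∸ i) + c) d≤i ⟩
    (k ∸ i) + c + i  ≡⟨ swap (k ∸ i) c i ⟩
    (k ∸ i) + i + c  ≡⟨ cong (_+ c) (m∸n+n≡m i≤k) ⟩
    k + c            <⟨ k+c<m+d ⟩
    m + d            ∎)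
    where
    swap : ∀ a c i → a + c + i ≡ a + i + c
    swap = solve-∀

  -- A factor fᵢ with 0 < i, which supplies one power of p, costs degree at
  -- least 1; the remaining factor then needs one power of p fewer.
  small-step : ∀ {p' j k n μ} → suc j ≤ k →
               WithinBound p' (suc n) (suc μ) k → WithinBound p' n μ (k ∸ suc j)
  small-step {p'} {j} {k} {n} {μ} j<k bound =
    +-cancelʳ-< p' ((k ∸ suc j) + p' * μ) (suc p' * n)
      (subst (_< suc p' * n + p') (sym (+-assoc (k ∸ suc j) (p' * μ) p'))
        (degree-drop (p' * μ + p') (suc p' * n + p') (s≤s z≤n) j<k
          (subst₂ _<_ (cong (λ c → k + c) (unfold-μ p' μ)) (unfold-n p' n) bound)))
    where
    unfold-μ : ∀ p' μ → p' * suc μ ≡ p' * μ + p'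
    unfold-μ = solve-∀
    unfold-n : ∀ p' n → suc p' * suc n ≡ suc p' * n + p' + 1
    unfold-n = solve-∀

  -- A factor fᵢ with i ≥ p costs degree at least p.
  large-step : ∀ {p' i k n ν} → suc p' ≤ i → i ≤ k →
               WithinBound p' (suc n) ν k → WithinBound p' n ν (k ∸ i)
  large-step {p'} {i} {k} {n} {ν} p≤i i≤k bound =
    degree-drop (p' * ν) (suc p' * n) p≤i i≤k (subst (k + p' * ν <_) (unfold p' n) bound)
    where
    unfold : ∀ p' n → suc p' * suc n ≡ suc p' * n + suc p'
    unfold = solve-∀

  -- At the edge ν = n, a factor fᵢ with i ≥ p leaves a coefficient below degree n.
  boundary-step : ∀ {p' i k n} → suc p' ≤ i → i ≤ k →
                  WithinBound p' (suc n) n k → k ∸ i < n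
  boundary-step {p'} {i} {k} {n} p≤i i≤k bound =
    +-cancelʳ-< (p' * n) (k ∸ i) n
      (degree-drop (p' * n) (n + p' * n) p≤i i≤k (subst (k + p' * n <_) (unfold p' n) bound))
    where
    unfold : ∀ p' n → suc p' * suc n ≡ n + p' * n + suc p'
    unfold = solve-∀

open DegreeBounds

module Powers where
  open import Data.Integer using (_*_)
  open import Data.Integer.Properties using (*-zeroˡ; *-zeroʳ; abs-*)
  open import Data.Nat.Divisibility using (*-pres-∣; 1∣_; _∣0) renaming (_∣_ to _∣ℕ_)
  open import Data.Nat.Properties using (m<1+n⇒m<n∨m≡n; ≮⇒≥)

  product-∣ : ∀ {x y : ℕ} {a b : ℤ} → + x ∣ˢ a → + y ∣ˢ b → + (x Data.Nat.* y) ∣ˢ a * b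
  product-∣ {a = a} {b} x∣a y∣b =
    ∣ᵤ⇒∣ (subst (_ ∣ℕ_) (sym (abs-* a b)) (*-pres-∣ (∣⇒∣ᵤ x∣a) (∣⇒∣ᵤ y∣b)))

  divides-zero : ∀ {d x : ℤ} → x ≡ + 0 → d ∣ˢ x
  divides-zero refl = ∣ᵤ⇒∣ (_ ∣0)

  powS-order : ∀ f → f 0 ≡ + 0 → ∀ n k → k < n → powS f n k ≡ + 0
  powS-order f f₀ (suc n) k k<n = sumTo-zero k _ term
    where
    term : ∀ i → i ≤ k → f i * powS f n (k ∸ i) ≡ + 0
    term zero    _ rewrite f₀ = *-zeroˡ (powS f n k)
    term (suc j) j<k rewrite powS-order f f₀ n (k ∸ suc j) (shorter-tail j<k k<n) = *-zeroʳ (f (suc j))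

  module _ (p' : ℕ) (f : PowerSeries) (f-zero : f 0 ≡ + 0)
           (f-low : ∀ j → suc j < suc p' → + suc p' ∣ˢ f (suc j)) where

    power-divisibility : ∀ n ν k → ν < n → WithinBound p' n ν k →
                         + (suc p' ^ suc ν) ∣ˢ powS f n k
    power-divisibility (suc n) ν k ν<n bound = sumTo-∣ k _ term
      where
      -- For 0 < i < p, fᵢ supplies one power of p and the rest of fⁿ supplies p^ν.
      from-factor : ∀ j → suc j < suc p' → suc j ≤ k → ∀ ν → ν < suc n →
                    WithinBound p' (suc n) ν k →
                    + (suc p' ^ suc ν) ∣ˢ f (suc j) * powS f n (k ∸ suc j)
      from-factor j j<p j<k zero    _           _     = product-∣ (f-low j j<p) (∣ᵤ⇒∣ (1∣ _))
      from-factor j j<p j<k (suc μ) (s≤s μ<n) bound =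
        product-∣ (f-low j j<p) (power-divisibility n μ (k ∸ suc j) μ<n (small-step {p'} {j} {k} {n} {μ} j<k bound))

      -- For i ≥ p, the rest of fⁿ supplies p^{ν+1}, or vanishes outright when ν = n.
      from-rest : ∀ i → suc p' ≤ i → i ≤ k → ∀ ν → ν < suc n →
                  WithinBound p' (suc n) ν k → + (suc p' ^ suc ν) ∣ˢ f i * powS f n (k ∸ i)
      from-rest i p≤i i≤k ν ν<n bound with m<1+n⇒m<n∨m≡n ν<n
      ... | inj₁ ν<n′ = Signed.∣n⇒∣m*n (f i)
                          (power-divisibility n ν (k ∸ i) ν<n′ (large-step p≤i i≤k bound))
      ... | inj₂ refl = divides-zero (trans
              (cong (f i *_) (powS-order f f-zero n (k ∸ i) (boundary-step p≤i i≤k bound)))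
              (*-zeroʳ (f i)))

      term : ∀ i → i ≤ k → + (suc p' ^ suc ν) ∣ˢ f i * powS f n (k ∸ i)
      term zero    _ = divides-zero (trans (cong (_* powS f n k) f-zero) (*-zeroˡ (powS f n k)))
      term (suc j) j<k with suc j <? suc p'
      ... | yes j<p = from-factor j j<p j<k ν ν<n bound
      ... | no  j≮p = from-rest (suc j) (≮⇒≥ j≮p) j<k ν ν<n bound

open Powers

lemma5 : (p λ' : ℕ) → Prime p → 1 ≤ λ' →
         (r : ℤ) (n : ℕ) → λ' ≤ n →
         (k : ℕ) → k < p Data.Nat.* n ∸ (p ∸ 1) Data.Nat.* (λ' ∸ 1) →
         (+ (p ^ λ')) ∣ powS (oneMinus (oneMinusQPow (r Data.Integer.* + p))) n k
lemma5 zero      λ'      p-prime = ⊥-elim (¬prime[0] p-prime)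
lemma5 (suc p')  zero    _ ()
lemma5 (suc p') (suc ν) p-prime _ r n λ≤n k k<bound =
  ∣⇒∣ᵤ (power-divisibility p' f f-zero f-low n ν k λ≤n (bound-from-difference k<bound))
  where
  z : ℤ
  z = r Data.Integer.* + suc p'

  p∣z : + suc p' ∣ˢ z
  p∣z = Signed.∣n⇒∣m*n r Signed.∣-refl

  f : PowerSeries
  f = oneMinus (oneMinusQPow z)

  f-zero : f 0 ≡ + 0
  f-zero rewrite oneMinusQPow-constant z = refl

  f-low : ∀ j → suc j < suc p' → + suc p' ∣ˢ f (suc j)
  f-low j j<p = subst (_ ∣ˢ_) (sym (+-identityˡ _))
    (Signed.∣m⇒∣-m (low-coefficient p-prime z j p∣z j<p))
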